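{- Let $T\ge 2$, let $1\le i\le T-1$, and let $\pi'$ and $\pi$ be binary strings of length $T$ which agree outside positions $i,i+1$ and satisfy $\pi'_i=1,\ \pi'_{i+1}=0$ and $\pi_i=0,\ \pi_{i+1}=1$. Let $\mathfrak{d}'$ be an arbitrarily labelled cylindric diagram with profile $\pi'$, let $m$ be the label of its box $(i,i+1,0)$, and let $\mathfrak{d}$ be the arbitrarily labelled cylindric diagram with profile $\pi$ obtained by removing this box, i.e. for every box $(a,b,k)\neq(i,i+1,0)$ of $\mathfrak{d}'$, the box $(\tau(a),\tau(b),k)$ of $\mathfrak{d}$ receives the same label, where $\tau$ is the transposition of $i$ and $i+1$ (fixing all other indices). Then \[ |\mathrm{diag}(i)|_{\mathfrak{d}'} \;=\; m + |\mathrm{diag}(i-1)|_{\mathfrak{d}} + |\mathrm{diag}(i+1)|_{\mathfrak{d}} - |\mathrm{diag}(i)|_{\mathfrak{d}}, \] where diagonal indices are read modulo $T$ (so $\mathrm{diag}(0)=\mathrm{diag}(T)$).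
   Context: For a binary string $\rho=\rho_1\cdots\rho_T$, the boxes of the cylindric diagram with profile $\rho$ are the triples $(a,b,k)$ of integers with $1\le a,b\le T$, $\rho_a=1$, $\rho_b=0$, and $k\ge 0$ if $a<b$, $k\ge1$ if $a>b$; its cylindric hook length is $b-a+kT$. An arbitrarily labelled cylindric diagram $\mathfrak{e}$ with profile $\rho$ assigns a non-negative integer label $\mathrm{lab}(a,b,k)$ to each box, with only finitely many non-zero labels. (One checks that $\tau$ maps boxes of $\pi'$ other than $(i,i+1,0)$ bijectively onto boxes of $\pi$.) For $t\in\{1,\ldots,T\}$ (indices taken modulo $T$), the weight of the $t$-th diagonal of $\mathfrak{e}$ is \[ |\mathrm{diag}(t)|_{\mathfrak{e}} = \sum_{\text{boxes }(a,b,k)} \mathrm{lab}(a,b,k)\cdot \#\{ s\in\mathbb{Z} : a\le s\le b-1+kT,\ s\equiv t \pmod T\}, \] i.e. each box contributes its label once for every cell of its hook lying on diagonal $t$; summing over $t$ gives $\sum \mathrm{lab}(a,b,k)(b-a+kT)$. -}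

module Defs where

open import Data.Bool using (Bool; true; false; _∧_; _∨_; not; if_then_else_)
open import Data.Nat using (ℕ; zero; suc; _+_; _*_; _∸_; _≤_; _<ᵇ_; _≤ᵇ_; _≡ᵇ_; NonZero)
open import Data.Nat.DivMod using (_%_)
open import Data.List using (List; []; _∷_; map; filter; length)
open import Data.Nat.ListAction using (sum)
open import Relation.Binary.PropositionalEquality using (_≡_)
open import Relation.Nullary.Decidable using (Dec)
import Data.Nat as N

-- Positions of a binary string of length T are 1,…,T.  A profile is a function
-- ℕ → Bool of which only the values at 1,…,T are ever consulted.

range : ℕ → ℕ → List ℕ
range lo zero = []
range lo (suc n) = lo ∷ range (suc lo) n

-- [lo, …, hi]  (empty if hi < lo)
interval : ℕ → ℕ → List ℕ
interval lo hi = range lo (suc hi ∸ lo)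

isBoxᵇ : ℕ → (ℕ → Bool) → ℕ → ℕ → ℕ → Bool
isBoxᵇ T ρ a b k =
  (1 ≤ᵇ a) ∧ (a ≤ᵇ T) ∧ (1 ≤ᵇ b) ∧ (b ≤ᵇ T) ∧ ρ a ∧ not (ρ b)
  ∧ ((a <ᵇ b) ∨ ((b <ᵇ a) ∧ (1 ≤ᵇ k)))

IsBox : ℕ → (ℕ → Bool) → ℕ → ℕ → ℕ → Set
IsBox T ρ a b k = isBoxᵇ T ρ a b k ≡ true

-- Arbitrarily labelled cylindric diagram with profile ρ: a label for each box,
-- only finitely many non-zero (all boxes with k ≥ bound have label 0;
-- since a, b range over 1..T this is exactly finite support).
record LabelledDiagram (T : ℕ) (ρ : ℕ → Bool) : Set where
  field
    lab     : ℕ → ℕ → ℕ → ℕ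
    bound   : ℕ
    support : ∀ a b k → IsBox T ρ a b k → bound ≤ k → lab a b k ≡ 0
open LabelledDiagram public

countCong : (T : ℕ) → .{{_ : NonZero T}} → ℕ → ℕ → ℕ → ℕ
countCong T t lo hi = length (filter (λ s → (s % T) N.≟ (t % T)) (interval lo hi))

boxContrib : (T : ℕ) → .{{_ : NonZero T}} → (ρ : ℕ → Bool) →
             LabelledDiagram T ρ → ℕ → ℕ → ℕ → ℕ → ℕ
boxContrib T ρ e t a b k =
  if isBoxᵇ T ρ a b k
  then lab e a b k * countCong T t a (b ∸ 1 + k * T)
  else 0

diagWeight : (T : ℕ) → .{{_ : NonZero T}} → (ρ : ℕ → Bool) →
             LabelledDiagram T ρ → ℕ → ℕ
diagWeight T ρ e t =
  sum (map (λ a → sum (map (λ b → sum (map (λ k → boxContrib T ρ e t a b k)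
        (range 0 (bound e)))) (range 1 T))) (range 1 T))

τ : ℕ → ℕ → ℕ
τ i a = if a ≡ᵇ i then suc i else (if a ≡ᵇ suc i then i else a)

-- A box (a, b, k) contributes its label times the number of cells of its hook
-- on the diagonal, and that hook is the half-open interval [a, b + kT).  The
-- transposition τ matches the boxes of π′ other than (i, i+1, 0) with the boxes
-- of π, keeping labels, so it suffices to prove the identity box by box.  For a
-- matched pair, the image hook arises by deleting the first cell when a = i and
-- the last cell when b = i+1, both lying on diagonal i; on the other hand the
-- second difference, in the diagonal index, of the cell counts of an interval
-- is concentrated at its two end cells, which produces exactly these
-- corrections.  The removed box has the one-cell hook {i} and contributes m.
module Submission where

open import Data.Bool using (Bool; true; false; _∧_; _∨_; not; if_then_else_)
import Data.Bool.Properties as Bool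
open import Data.Bool.Properties using (¬-not)
open import Data.Empty using (⊥-elim)
open import Data.List using (List; []; _∷_; map; filter; length)
open import Data.List.Properties using (map-cong)
open import Data.Nat.ListAction using (sum)
open import Data.Nat
open import Data.Nat.DivMod
open import Data.Nat.Properties
open import Data.Nat.Tactic.RingSolver using (solve-∀)
open import Data.Product using (_×_; _,_; proj₁; proj₂)
open import Data.Sum using (_⊎_; inj₁; inj₂)
open import Relation.Binary.PropositionalEquality
open import Relation.Nullary using (¬_; yes; no; does; contradiction)
open import Relation.Nullary.Decidable using (Dec; dec-true; dec-false; _×-dec_)

open import Defs

≡ᵇ-true : ∀ {m n} → m ≡ n → (m ≡ᵇ n) ≡ true
≡ᵇ-true {m} {n} = dec-true (m ≟ n)

≡ᵇ-false : ∀ {m n} → m ≢ n → (m ≡ᵇ n) ≡ false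
≡ᵇ-false {m} {n} = dec-false (m ≟ n)

<ᵇ-true : ∀ {m n} → m < n → (m <ᵇ n) ≡ true
<ᵇ-true {m} {n} = dec-true (m <? n)

<ᵇ-false : ∀ {m n} → ¬ m < n → (m <ᵇ n) ≡ false
<ᵇ-false {m} {n} = dec-false (m <? n)

≤ᵇ-true : ∀ {m n} → m ≤ n → (m ≤ᵇ n) ≡ true
≤ᵇ-true {m} {n} = dec-true (m ≤? n)

<ᵇ-sound : ∀ {m n} → (m <ᵇ n) ≡ true → m < n
<ᵇ-sound {m} {n} e with m <? n
... | yes m<n = m<n
... | no m≮n  = contradiction (trans (sym e) (<ᵇ-false m≮n)) λ ()

≤ᵇ-sound : ∀ {m n} → (m ≤ᵇ n) ≡ true → m ≤ n
≤ᵇ-sound {m} {n} e with m ≤? n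
... | yes m≤n = m≤n
... | no m≰n  = contradiction (trans (sym e) (dec-false (m ≤? n) m≰n)) λ ()

Position : ℕ → ℕ → Set
Position T a = 1 ≤ a × a ≤ T

module Diagonals (T : ℕ) .{{_ : NonZero T}} where

  onDiag : ℕ → ℕ → ℕ
  onDiag t x = if does (x % T ≟ t % T) then 1 else 0

  onDiag-≡ : ∀ {t x} → x % T ≡ t % T → onDiag t x ≡ 1
  onDiag-≡ {t} {x} e = cong (if_then 1 else 0) (dec-true (x % T ≟ t % T) e)

  onDiag-≢ : ∀ {t x} → x % T ≢ t % T → onDiag t x ≡ 0
  onDiag-≢ {t} {x} ne = cong (if_then 1 else 0) (dec-false (x % T ≟ t % T) ne)

  onDiag-refl : ∀ t → onDiag t t ≡ 1
  onDiag-refl t = onDiag-≡ refl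

  onDiag-period : ∀ t x k → onDiag t (x + k * T) ≡ onDiag t x
  onDiag-period t x k = cong (λ r → if does (r ≟ t % T) then 1 else 0) ([m+kn]%n≡m%n x k T)

  suc-cong-mod : ∀ {x y} → x % T ≡ y % T → suc x % T ≡ suc y % T
  suc-cong-mod {x} {y} e = begin
      (1 + x) % T            ≡⟨ %-distribˡ-+ 1 x T ⟩
      (1 % T + x % T) % T    ≡⟨ cong (λ r → (1 % T + r) % T) e ⟩
      (1 % T + y % T) % T    ≡⟨ %-distribˡ-+ 1 y T ⟨
      (1 + y) % T            ∎
    where open ≡-Reasoning

  suc-cancel-mod : ∀ {x y} → suc x % T ≡ suc y % T → x % T ≡ y % T
  suc-cancel-mod {x} {y} e = begin
      x % T                          ≡⟨ [m+n]%n≡m%n x T ⟨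
      (x + T) % T                    ≡⟨ cong (_% T) (+-minus-one x) ⟩
      (suc x + (T ∸ 1)) % T          ≡⟨ %-distribˡ-+ (suc x) (T ∸ 1) T ⟩
      (suc x % T + (T ∸ 1) % T) % T  ≡⟨ cong (λ r → (r + (T ∸ 1) % T) % T) e ⟩
      (suc y % T + (T ∸ 1) % T) % T  ≡⟨ %-distribˡ-+ (suc y) (T ∸ 1) T ⟨
      (suc y + (T ∸ 1)) % T          ≡⟨ cong (_% T) (+-minus-one y) ⟨
      (y + T) % T                    ≡⟨ [m+n]%n≡m%n y T ⟩
      y % T                          ∎
    where
    open ≡-Reasoning
    +-minus-one : ∀ z → z + T ≡ suc z + (T ∸ 1)
    +-minus-one z = trans (cong (z +_) (sym (suc-pred T))) (+-suc z (T ∸ 1))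

  onDiag-suc : ∀ t x → onDiag (suc t) (suc x) ≡ onDiag t x
  onDiag-suc t x with x % T ≟ t % T
  ... | yes e = trans (onDiag-≡ (suc-cong-mod e)) (sym (onDiag-≡ e))
  ... | no ne = trans (onDiag-≢ (λ e → ne (suc-cancel-mod e))) (sym (onDiag-≢ ne))

  onDiag-distinct : ∀ {t x} → Position T x → Position T t → x ≢ t → onDiag t x ≡ 0
  onDiag-distinct {t} {x} (1≤x , x≤T) (1≤t , t≤T) x≢t = onDiag-≢ λ e → x≢t (residue-injective x t 1≤x x≤T 1≤t t≤T e)
    where
    positive : ∀ {z} → 1 ≤ z → z ≢ 0
    positive 1≤z z≡0 = <⇒≢ 1≤z (sym z≡0)
    residue-injective : ∀ x t → 1 ≤ x → x ≤ T → 1 ≤ t → t ≤ T → x % T ≡ t % T → x ≡ t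
    residue-injective x t 1≤x x≤T 1≤t t≤T e with m≤n⇒m<n∨m≡n x≤T | m≤n⇒m<n∨m≡n t≤T
    ... | inj₁ x<T | inj₁ t<T = trans (sym (m<n⇒m%n≡m x<T)) (trans e (m<n⇒m%n≡m t<T))
    ... | inj₂ x≡T | inj₂ t≡T = trans x≡T (sym t≡T)
    ... | inj₁ x<T | inj₂ refl = ⊥-elim (positive 1≤x (trans (sym (m<n⇒m%n≡m x<T)) (trans e (n%n≡0 T))))
    ... | inj₂ refl | inj₁ t<T = ⊥-elim (positive 1≤t (trans (sym (m<n⇒m%n≡m t<T)) (trans (sym e) (n%n≡0 T))))

  cells : ℕ → ℕ → ℕ → ℕ
  cells t lo len = length (filter (λ s → s % T ≟ t % T) (range lo len))

  cells-cons : ∀ t lo len → cells t lo (suc len) ≡ onDiag t lo + cells t (suc lo) len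
  cells-cons t lo len with does (lo % T ≟ t % T)
  ... | true  = refl
  ... | false = refl

  cells-snoc : ∀ t lo len → cells t lo (suc len) ≡ cells t lo len + onDiag t (lo + len)
  cells-snoc t lo zero = begin
      cells t lo 1         ≡⟨ cells-cons t lo 0 ⟩
      onDiag t lo + 0      ≡⟨ +-comm (onDiag t lo) 0 ⟩
      onDiag t lo          ≡⟨ cong (onDiag t) (+-identityʳ lo) ⟨
      onDiag t (lo + 0)    ∎
    where open ≡-Reasoning
  cells-snoc t lo (suc len) = begin
      cells t lo (suc (suc len))
        ≡⟨ cells-cons t lo (suc len) ⟩
      onDiag t lo + cells t (suc lo) (suc len)
        ≡⟨ cong (onDiag t lo +_) (cells-snoc t (suc lo) len) ⟩
      onDiag t lo + (cells t (suc lo) len + onDiag t (suc lo + len))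
        ≡⟨ +-assoc (onDiag t lo) _ _ ⟨
      onDiag t lo + cells t (suc lo) len + onDiag t (suc lo + len)
        ≡⟨ cong₂ _+_ (cells-cons t lo len) (cong (onDiag t) (+-suc lo len)) ⟨
      cells t lo (suc len) + onDiag t (lo + suc len)
        ∎
    where open ≡-Reasoning

  -- Passing to the next diagonal changes the count of a run only at its ends:
  -- its first cell lo may be lost from diagonal t, and the cell lo+len after its
  -- end may be gained on diagonal t+1.
  cells-nextDiag : ∀ t lo len →
    cells (suc t) lo len + onDiag (suc t) (lo + len) ≡ onDiag (suc t) lo + cells t lo len
  cells-nextDiag t lo zero = trans (cong (onDiag (suc t)) (+-identityʳ lo)) (sym (+-identityʳ _))
  cells-nextDiag t lo (suc len) = begin
      cells (suc t) lo (suc len) + onDiag (suc t) (lo + suc len)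
        ≡⟨ cong₂ _+_ (cells-cons (suc t) lo len) (cong (onDiag (suc t)) (+-suc lo len)) ⟩
      onDiag (suc t) lo + cells (suc t) (suc lo) len + onDiag (suc t) (suc lo + len)
        ≡⟨ +-assoc (onDiag (suc t) lo) _ _ ⟩
      onDiag (suc t) lo + (cells (suc t) (suc lo) len + onDiag (suc t) (suc lo + len))
        ≡⟨ cong (onDiag (suc t) lo +_) (cells-nextDiag t (suc lo) len) ⟩
      onDiag (suc t) lo + (onDiag (suc t) (suc lo) + cells t (suc lo) len)
        ≡⟨ cong (λ z → onDiag (suc t) lo + (z + cells t (suc lo) len)) (onDiag-suc t lo) ⟩
      onDiag (suc t) lo + (onDiag t lo + cells t (suc lo) len)
        ≡⟨ cong (onDiag (suc t) lo +_) (cells-cons t lo len) ⟨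
      onDiag (suc t) lo + cells t lo (suc len)
        ∎
    where open ≡-Reasoning

  span : ℕ → ℕ → ℕ → ℕ
  span t a e = cells t a (e ∸ a)

  span-start : ∀ t {a e} → a < e → span t a e ≡ onDiag t a + span t (suc a) e
  span-start t {a} {suc e} (s≤s a≤e) =
    trans (cong (cells t a) (+-∸-assoc 1 a≤e)) (cells-cons t a (e ∸ a))

  span-single : ∀ t → span t t (suc t) ≡ 1
  span-single t = trans (span-start t (n<1+n t)) (cong₂ _+_ (onDiag-refl t) (cong (cells t (suc t)) (n∸n≡0 t)))

  span-end : ∀ t {a e} → a ≤ e → span t a (suc e) ≡ span t a e + onDiag t e
  span-end t {a} {e} a≤e = begin
      cells t a (suc e ∸ a)                      ≡⟨ cong (cells t a) (+-∸-assoc 1 a≤e) ⟩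
      cells t a (suc (e ∸ a))                    ≡⟨ cells-snoc t a (e ∸ a) ⟩
      cells t a (e ∸ a) + onDiag t (a + (e ∸ a)) ≡⟨ cong (λ z → span t a e + onDiag t z) (m+[n∸m]≡n a≤e) ⟩
      span t a e + onDiag t e                    ∎
    where open ≡-Reasoning

  span-nextDiag : ∀ t {a e} → a ≤ e → span (suc t) a e + onDiag (suc t) e ≡ onDiag (suc t) a + span t a e
  span-nextDiag t {a} {e} a≤e =
    trans (cong (λ z → span (suc t) a e + onDiag (suc t) z) (sym (m+[n∸m]≡n a≤e))) (cells-nextDiag t a (e ∸ a))

  -- The discrete second difference of span in the diagonal index lives on the
  -- two ends of the interval; this is the heart of the diagonal relation.
  span-secondDiff : ∀ t {a e} → a ≤ e →
    span t a e + span (2 + t) a e + onDiag (1 + t) a + onDiag (2 + t) e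
      ≡ span (1 + t) a e + span (1 + t) a e + onDiag (2 + t) a + onDiag (1 + t) e
  span-secondDiff t {a} {e} a≤e = begin
      S₀ + S₂ + o₁a + o₂e     ≡⟨ regroup S₀ S₂ o₁a o₂e ⟩
      (o₁a + S₀) + (S₂ + o₂e) ≡⟨ cong₂ _+_ (sym (span-nextDiag t a≤e)) (span-nextDiag (suc t) a≤e) ⟩
      (S₁ + o₁e) + (o₂a + S₁) ≡⟨ regroup′ S₁ o₁e o₂a ⟩
      S₁ + S₁ + o₂a + o₁e     ∎
    where
    open ≡-Reasoning
    S₀ = span t a e
    S₁ = span (1 + t) a e
    S₂ = span (2 + t) a e
    o₁a = onDiag (1 + t) a
    o₂a = onDiag (2 + t) a
    o₁e = onDiag (1 + t) e
    o₂e = onDiag (2 + t) e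
    regroup : ∀ w x y z → w + x + y + z ≡ (y + w) + (x + z)
    regroup = solve-∀
    regroup′ : ∀ x y z → (x + y) + (z + x) ≡ x + x + z + y
    regroup′ = solve-∀

  -- The factor of a box (a, b, k) in boxContrib counts the cells of its hook [a, b + kT).
  hook-count : ∀ t a {b} k → 1 ≤ b → countCong T t a (b ∸ 1 + k * T) ≡ span t a (b + k * T)
  hook-count t a {suc b} k _ = refl

τ-left : ∀ i → τ i i ≡ suc i
τ-left i rewrite ≡ᵇ-true {i} refl = refl

τ-right : ∀ i → τ i (suc i) ≡ i
τ-right i rewrite ≡ᵇ-false {suc i} {i} 1+n≢n | ≡ᵇ-true {i} refl = refl

τ-fixed : ∀ i {a} → a ≢ i → a ≢ suc i → τ i a ≡ a
τ-fixed i a≢i a≢i+1 rewrite ≡ᵇ-false a≢i | ≡ᵇ-false a≢i+1 = refl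

<ᵇ-suc-left : ∀ x y → x ≢ suc y → (suc y <ᵇ x) ≡ (y <ᵇ x)
<ᵇ-suc-left x y x≢y+1 with y <? x
... | yes y<x = trans (<ᵇ-true (≤∧≢⇒< y<x (λ e → x≢y+1 (sym e)))) (sym (<ᵇ-true y<x))
... | no y≮x  = trans (<ᵇ-false (λ y+1<x → y≮x (<-trans (n<1+n y) y+1<x))) (sym (<ᵇ-false y≮x))

<ᵇ-suc-right : ∀ x y → x ≢ y → (x <ᵇ suc y) ≡ (x <ᵇ y)
<ᵇ-suc-right x y x≢y with x <? y
... | yes x<y = trans (<ᵇ-true (<-trans x<y (n<1+n y))) (sym (<ᵇ-true x<y))
... | no x≮y  = trans (<ᵇ-false (λ x<y+1 → x≮y (≤∧≢⇒< (≤-pred x<y+1) x≢y))) (sym (<ᵇ-false x≮y))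

boxOrder : ℕ → ℕ → ℕ → Bool
boxOrder a b k = (a <ᵇ b) ∨ ((b <ᵇ a) ∧ (1 ≤ᵇ k))

isBox-positions : ∀ T ρ {a b} k → Position T a → Position T b →
  isBoxᵇ T ρ a b k ≡ ρ a ∧ not (ρ b) ∧ boxOrder a b k
isBox-positions T ρ k (1≤a , a≤T) (1≤b , b≤T)
  rewrite ≤ᵇ-true 1≤a | ≤ᵇ-true a≤T | ≤ᵇ-true 1≤b | ≤ᵇ-true b≤T = refl

∧-not-∧-true : ∀ x y z → x ∧ not y ∧ z ≡ true → x ≡ true × y ≡ false × z ≡ true
∧-not-∧-true true false true _ = refl , refl , refl

box-facts : ∀ T ρ {a b} k → Position T a → Position T b → IsBox T ρ a b k →
  ρ a ≡ true × ρ b ≡ false × boxOrder a b k ≡ true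
box-facts T ρ k pa pb box = ∧-not-∧-true _ _ _ (trans (sym (isBox-positions T ρ k pa pb)) box)

∨-∧-true : ∀ x y z → x ∨ (y ∧ z) ≡ true → x ≡ true ⊎ z ≡ true
∨-∧-true true  _    _ _ = inj₁ refl
∨-∧-true false true z e = inj₂ e

hook-nonempty : ∀ T {a b k} → a ≤ T → 1 ≤ b → boxOrder a b k ≡ true → a < b + k * T
hook-nonempty T {a} {b} {k} a≤T 1≤b ord with ∨-∧-true (a <ᵇ b) (b <ᵇ a) (1 ≤ᵇ k) ord
... | inj₁ a<ᵇb = <-≤-trans (<ᵇ-sound a<ᵇb) (m≤m+n b (k * T))
... | inj₂ 1≤ᵇk = begin-strict
    a          ≤⟨ a≤T ⟩
    T          ≤⟨ m≤n*m T k {{>-nonZero (≤ᵇ-sound 1≤ᵇk)}} ⟩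
    k * T      <⟨ m<n+m (k * T) 1≤b ⟩
    b + k * T  ∎
  where open ≤-Reasoning

box-hook : ∀ T ρ {a b} k → Position T a → Position T b → IsBox T ρ a b k → a < b + k * T
box-hook T ρ k (1≤a , a≤T) (1≤b , b≤T) box =
  hook-nonempty T {k = k} a≤T 1≤b (proj₂ (proj₂ (box-facts T ρ k (1≤a , a≤T) (1≤b , b≤T) box)))

rangeSum : ℕ → ℕ → (ℕ → ℕ) → ℕ
rangeSum lo len f = sum (map f (range lo len))

sum-map-+ : ∀ (l : List ℕ) f g → sum (map (λ x → f x + g x) l) ≡ sum (map f l) + sum (map g l)
sum-map-+ []      f g = refl
sum-map-+ (x ∷ l) f g = trans (cong (f x + g x +_) (sum-map-+ l f g)) (interchange (f x) (g x) _ _)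
  where
  interchange : ∀ w x y z → w + x + (y + z) ≡ w + y + (x + z)
  interchange = solve-∀

rangeSum-cong : ∀ lo len {f g} → (∀ x → lo ≤ x → x < lo + len → f x ≡ g x) →
  rangeSum lo len f ≡ rangeSum lo len g
rangeSum-cong lo zero      h = refl
rangeSum-cong lo (suc len) h = cong₂ _+_ (h lo ≤-refl (m<m+n lo z<s))
  (rangeSum-cong (suc lo) len λ x lo<x x<end → h x (<⇒≤ lo<x) (subst (x <_) (sym (+-suc lo len)) x<end))

rangeSum-zero : ∀ lo len {f} → (∀ x → lo ≤ x → f x ≡ 0) → rangeSum lo len f ≡ 0
rangeSum-zero lo zero      h = refl
rangeSum-zero lo (suc len) h = cong₂ _+_ (h lo ≤-refl) (rangeSum-zero (suc lo) len λ x lo<x → h x (<⇒≤ lo<x))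

rangeSum-extend : ∀ lo {len len′ f} → len ≤ len′ → (∀ x → lo + len ≤ x → f x ≡ 0) →
  rangeSum lo len f ≡ rangeSum lo len′ f
rangeSum-extend lo {zero} {len′} _ h =
  sym (rangeSum-zero lo len′ λ x lo≤x → h x (subst (_≤ x) (sym (+-identityʳ lo)) lo≤x))
rangeSum-extend lo {suc len} {suc len′} {f} (s≤s len≤len′) h =
  cong (f lo +_) (rangeSum-extend (suc lo) len≤len′ λ x end≤x → h x (subst (_≤ x) (sym (+-suc lo len)) end≤x))

rangeSum-point : ∀ lo len {f x₀} → lo ≤ x₀ → x₀ < lo + len → (∀ x → x ≢ x₀ → f x ≡ 0) →
  rangeSum lo len f ≡ f x₀
rangeSum-point lo zero {x₀ = x₀} lo≤x₀ x₀<lo _ =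
  contradiction (subst (x₀ <_) (+-identityʳ lo) x₀<lo) (≤⇒≯ lo≤x₀)
rangeSum-point lo (suc len) {f} {x₀} lo≤x₀ x₀<end h with lo ≟ x₀
... | yes refl = trans (cong (f lo +_) (rangeSum-zero (suc lo) len λ x lo<x → h x (>⇒≢ lo<x)))
                       (+-identityʳ (f lo))
... | no lo≢x₀ = trans (cong (_+ rangeSum (suc lo) len f) (h lo lo≢x₀))
                       (rangeSum-point (suc lo) len (≤∧≢⇒< lo≤x₀ lo≢x₀) (subst (x₀ <_) (+-suc lo len) x₀<end) h)

rangeSum-τ : ∀ i lo len f → lo ≤ i → suc i < lo + len →
  rangeSum lo len (λ x → f (τ i x)) ≡ rangeSum lo len f
rangeSum-τ i lo zero f lo≤i i+1<lo =
  contradiction (≤-trans lo≤i (n≤1+n i)) (<⇒≱ (subst (suc i <_) (+-identityʳ lo) i+1<lo))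
rangeSum-τ i lo (suc len) f lo≤i i+1<end with m≤n⇒m<n∨m≡n lo≤i
... | inj₁ lo<i = cong₂ _+_
      (cong f (τ-fixed i (<⇒≢ lo<i) (<⇒≢ (<-trans lo<i (n<1+n i)))))
      (rangeSum-τ i (suc lo) len f lo<i (subst (suc i <_) (+-suc lo len) i+1<end))
... | inj₂ refl with len
...   | zero = contradiction (subst (suc i <_) (+-comm i 1) i+1<end) (<-irrefl refl)
...   | suc len′ = begin
      f (τ i i) + (f (τ i (suc i)) + rangeSum (2 + i) len′ (λ x → f (τ i x)))
        ≡⟨ cong₂ (λ x y → f x + (f y + rangeSum (2 + i) len′ (λ x → f (τ i x)))) (τ-left i) (τ-right i) ⟩
      f (suc i) + (f i + rangeSum (2 + i) len′ (λ x → f (τ i x)))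
        ≡⟨ cong (λ r → f (suc i) + (f i + r)) (rangeSum-cong (2 + i) len′ λ x i+1<x _ →
             cong f (τ-fixed i (>⇒≢ (<-trans (n<1+n i) i+1<x)) (>⇒≢ i+1<x))) ⟩
      f (suc i) + (f i + rangeSum (2 + i) len′ f)
        ≡⟨ swap (f (suc i)) (f i) _ ⟩
      f i + (f (suc i) + rangeSum (2 + i) len′ f)
        ∎
    where
    open ≡-Reasoning
    swap : ∀ x y z → x + (y + z) ≡ y + (x + z)
    swap = solve-∀

boxSum : ℕ → ℕ → (ℕ → ℕ → ℕ → ℕ) → ℕ
boxSum T K G = rangeSum 1 T λ a → rangeSum 1 T λ b → rangeSum 0 K (G a b)

boxSum-+ : ∀ T K F G → boxSum T K (λ a b k → F a b k + G a b k) ≡ boxSum T K F + boxSum T K G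
boxSum-+ T K F G = begin
    rangeSum 1 T (λ a → rangeSum 1 T λ b → rangeSum 0 K (λ k → F a b k + G a b k))
      ≡⟨ cong sum (map-cong (λ a → cong sum (map-cong (λ b → sum-map-+ (range 0 K) (F a b) (G a b)) (range 1 T))) (range 1 T)) ⟩
    rangeSum 1 T (λ a → rangeSum 1 T λ b → ΣF a b + ΣG a b)
      ≡⟨ cong sum (map-cong (λ a → sum-map-+ (range 1 T) (ΣF a) (ΣG a)) (range 1 T)) ⟩
    rangeSum 1 T (λ a → rangeSum 1 T (ΣF a) + rangeSum 1 T (ΣG a))
      ≡⟨ sum-map-+ (range 1 T) _ _ ⟩
    boxSum T K F + boxSum T K G
      ∎
  where
  open ≡-Reasoning
  ΣF ΣG : ℕ → ℕ → ℕ
  ΣF a b = rangeSum 0 K (F a b)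
  ΣG a b = rangeSum 0 K (G a b)

boxSum-cong : ∀ T K {F G} → (∀ a b k → Position T a → Position T b → F a b k ≡ G a b k) →
  boxSum T K F ≡ boxSum T K G
boxSum-cong T K h = rangeSum-cong 1 T λ a 1≤a a<1+T → rangeSum-cong 1 T λ b 1≤b b<1+T →
  cong sum (map-cong (λ k → h a b k (1≤a , ≤-pred a<1+T) (1≤b , ≤-pred b<1+T)) (range 0 K))

boxSum-extend : ∀ T {K K′ G} → K ≤ K′ → (∀ a b k → K ≤ k → G a b k ≡ 0) → boxSum T K G ≡ boxSum T K′ G
boxSum-extend T K≤K′ h = cong sum (map-cong (λ a → cong sum (map-cong (λ b →
  rangeSum-extend 0 K≤K′ (h a b)) (range 1 T))) (range 1 T))

boxSum-τ : ∀ T K i G → 1 ≤ i → suc i ≤ T →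
  boxSum T K (λ a b k → G (τ i a) (τ i b) k) ≡ boxSum T K G
boxSum-τ T K i G 1≤i i+1≤T = trans
  (cong sum (map-cong (λ a → rangeSum-τ i 1 T (λ b → rangeSum 0 K (G (τ i a) b)) 1≤i (s≤s i+1≤T)) (range 1 T)))
  (rangeSum-τ i 1 T (λ a → rangeSum 1 T λ b → rangeSum 0 K (G a b)) 1≤i (s≤s i+1≤T))

boxSum-point : ∀ T K {G a₀ b₀ k₀} → Position T a₀ → Position T b₀ → k₀ < K →
  (∀ a b k → ¬ (a ≡ a₀ × b ≡ b₀ × k ≡ k₀) → G a b k ≡ 0) → boxSum T K G ≡ G a₀ b₀ k₀
boxSum-point T K {G} {a₀} {b₀} {k₀} (1≤a₀ , a₀≤T) (1≤b₀ , b₀≤T) k₀<K h = begin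
    boxSum T K G
      ≡⟨ rangeSum-point 1 T 1≤a₀ (s≤s a₀≤T) (λ a a≢a₀ →
           rangeSum-zero 1 T λ b _ → rangeSum-zero 0 K λ k _ → h a b k λ (a≡a₀ , _) → a≢a₀ a≡a₀) ⟩
    rangeSum 1 T (λ b → rangeSum 0 K (G a₀ b))
      ≡⟨ rangeSum-point 1 T 1≤b₀ (s≤s b₀≤T) (λ b b≢b₀ →
           rangeSum-zero 0 K λ k _ → h a₀ b k λ (_ , b≡b₀ , _) → b≢b₀ b≡b₀) ⟩
    rangeSum 0 K (G a₀ b₀)
      ≡⟨ rangeSum-point 0 K z≤n k₀<K (λ k k≢k₀ → h a₀ b₀ k λ (_ , _ , k≡k₀) → k≢k₀ k≡k₀) ⟩
    G a₀ b₀ k₀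
      ∎
  where open ≡-Reasoning

boxContrib-box : ∀ {T} .{{_ : NonZero T}} {ρ} (e : LabelledDiagram T ρ) t {a b k} → IsBox T ρ a b k →
  boxContrib T ρ e t a b k ≡ lab e a b k * countCong T t a (b ∸ 1 + k * T)
boxContrib-box e t box = cong (if_then _ else 0) box

boxContrib-nonbox : ∀ {T} .{{_ : NonZero T}} {ρ} (e : LabelledDiagram T ρ) t {a b k} → isBoxᵇ T ρ a b k ≡ false →
  boxContrib T ρ e t a b k ≡ 0
boxContrib-nonbox e t nonbox = cong (if_then _ else 0) nonbox

boxContrib-beyond : ∀ {T} .{{_ : NonZero T}} {ρ} (e : LabelledDiagram T ρ) t a b k → bound e ≤ k →
  boxContrib T ρ e t a b k ≡ 0
boxContrib-beyond {T} {ρ} e t a b k bound≤k =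
  if-vanishes (isBoxᵇ T ρ a b k) λ box → cong (_* countCong T t a (b ∸ 1 + k * T)) (support e a b k box bound≤k)
  where
  if-vanishes : ∀ c {x} → (c ≡ true → x ≡ 0) → (if c then x else 0) ≡ 0
  if-vanishes true  h = h refl
  if-vanishes false h = refl

∧-not-∧-congʳ : ∀ x y {z w} → (x ≡ true → y ≡ false → z ≡ w) → x ∧ not y ∧ z ≡ x ∧ not y ∧ w
∧-not-∧-congʳ true  false h = h refl refl
∧-not-∧-congʳ true  true  h = refl
∧-not-∧-congʳ false _     h = refl

-- The setting of the theorem: the profiles π′ and π differ exactly by exchanging
-- the adjacent positions i = j+1 and i+1, with π′ = …10… and π = …01… there.
module Swap (T : ℕ) .{{_ : NonZero T}} (j : ℕ) (i+1≤T : suc (suc j) ≤ T) (π′ π : ℕ → Bool)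
  (agree : ∀ a → 1 ≤ a → a ≤ T → a ≢ suc j → a ≢ suc (suc j) → π′ a ≡ π a)
  (π′i≡1 : π′ (suc j) ≡ true) (π′i+1≡0 : π′ (suc (suc j)) ≡ false)
  (πi≡0 : π (suc j) ≡ false) (πi+1≡1 : π (suc (suc j)) ≡ true) where

  open Diagonals T

  i : ℕ
  i = suc j

  pos-i : Position T i
  pos-i = s≤s z≤n , ≤-trans (n≤1+n i) i+1≤T

  pos-i+1 : Position T (suc i)
  pos-i+1 = s≤s z≤n , i+1≤T

  π∘τ : ∀ {a} → Position T a → π (τ i a) ≡ π′ a
  π∘τ {a} (1≤a , a≤T) with a ≟ i | a ≟ suc i
  ... | yes refl | _        = trans (cong π (τ-left i)) (trans πi+1≡1 (sym π′i≡1))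
  ... | no _     | yes refl = trans (cong π (τ-right i)) (trans πi≡0 (sym π′i+1≡0))
  ... | no a≢i   | no a≢i+1 = trans (cong π (τ-fixed i a≢i a≢i+1)) (sym (agree a 1≤a a≤T a≢i a≢i+1))

  τ-position : ∀ {a} → Position T a → Position T (τ i a)
  τ-position {a} pa with a ≟ i | a ≟ suc i
  ... | yes refl | _        = subst (Position T) (sym (τ-left i)) pos-i+1
  ... | no _     | yes refl = subst (Position T) (sym (τ-right i)) pos-i
  ... | no a≢i   | no a≢i+1 = subst (Position T) (sym (τ-fixed i a≢i a≢i+1)) pa

  π′-filled : ∀ {a} → π′ a ≡ true → a ≢ suc i
  π′-filled e refl = contradiction (trans (sym π′i+1≡0) e) λ ()

  π′-empty : ∀ {b} → π′ b ≡ false → b ≢ i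
  π′-empty e refl = contradiction (trans (sym e) π′i≡1) λ ()

  π-filled : ∀ {a} → π a ≡ true → a ≢ i
  π-filled e refl = contradiction (trans (sym πi≡0) e) λ ()

  π-empty : ∀ {b} → π b ≡ false → b ≢ suc i
  π-empty e refl = contradiction (trans (sym e) πi+1≡1) λ ()

  Special : ℕ → ℕ → ℕ → Set
  Special a b k = a ≡ i × b ≡ suc i × k ≡ 0

  τ-boxOrder : ∀ {a b} k → π′ a ≡ true → π′ b ≡ false → ¬ Special a b k →
    boxOrder (τ i a) (τ i b) k ≡ boxOrder a b k
  τ-boxOrder {a} {b} k a↦1 b↦0 ¬special with a ≟ i | b ≟ suc i | k
  ... | yes refl | yes refl | zero   = contradiction (refl , refl , refl) ¬special
  ... | yes refl | yes refl | suc _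
    rewrite τ-left i | τ-right i | <ᵇ-false (<-asym (n<1+n i)) | <ᵇ-true (n<1+n i) = refl
  ... | yes refl | no b≢i+1 | _
    rewrite τ-left i | τ-fixed i (π′-empty b↦0) b≢i+1
          | <ᵇ-suc-left b i b≢i+1 | <ᵇ-suc-right b i (π′-empty b↦0) = refl
  ... | no a≢i | yes refl | _
    rewrite τ-right i | τ-fixed i a≢i (π′-filled a↦1)
          | <ᵇ-suc-left a i (π′-filled a↦1) | <ᵇ-suc-right a i a≢i = refl
  ... | no a≢i | no b≢i+1 | _
    rewrite τ-fixed i a≢i (π′-filled a↦1) | τ-fixed i (π′-empty b↦0) b≢i+1 = refl

  τ-isBox : ∀ {a b} k → Position T a → Position T b → ¬ Special a b k →
    isBoxᵇ T π (τ i a) (τ i b) k ≡ isBoxᵇ T π′ a b k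
  τ-isBox {a} {b} k pa pb ¬special = begin
      isBoxᵇ T π (τ i a) (τ i b) k
        ≡⟨ isBox-positions T π k (τ-position pa) (τ-position pb) ⟩
      π (τ i a) ∧ not (π (τ i b)) ∧ boxOrder (τ i a) (τ i b) k
        ≡⟨ cong₂ (λ x y → x ∧ not y ∧ boxOrder (τ i a) (τ i b) k) (π∘τ pa) (π∘τ pb) ⟩
      π′ a ∧ not (π′ b) ∧ boxOrder (τ i a) (τ i b) k
        ≡⟨ ∧-not-∧-congʳ (π′ a) (π′ b) (λ a↦1 b↦0 → τ-boxOrder k a↦1 b↦0 ¬special) ⟩
      π′ a ∧ not (π′ b) ∧ boxOrder a b k
        ≡⟨ isBox-positions T π′ k pa pb ⟨
      isBoxᵇ T π′ a b k
        ∎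
    where open ≡-Reasoning

  special-box : IsBox T π′ i (suc i) 0
  special-box rewrite isBox-positions T π′ 0 pos-i pos-i+1 | π′i≡1 | π′i+1≡0 | <ᵇ-true (n<1+n i) = refl

  special-image : isBoxᵇ T π (suc i) i 0 ≡ false
  special-image rewrite isBox-positions T π 0 pos-i+1 pos-i | πi≡0 | πi+1≡1
    | <ᵇ-false (<-asym (n<1+n i)) | <ᵇ-true (n<1+n i) = refl

  start-move : ∀ {a e} → Position T a → a ≢ suc i → a < e →
    span i a e ≡ span i (τ i a) e + onDiag (suc i) (τ i a)
  start-move {a} {e} pa a≢i+1 a<e with a ≟ i
  ... | yes refl rewrite τ-left i = begin
      span i i e                                 ≡⟨ span-start i a<e ⟩
      onDiag i i + span i (suc i) e              ≡⟨ cong (_+ span i (suc i) e) (onDiag-refl i) ⟩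
      1 + span i (suc i) e                       ≡⟨ +-comm 1 _ ⟩
      span i (suc i) e + 1                       ≡⟨ cong (span i (suc i) e +_) (onDiag-refl (suc i)) ⟨
      span i (suc i) e + onDiag (suc i) (suc i)  ∎
    where open ≡-Reasoning
  ... | no a≢i rewrite τ-fixed i a≢i a≢i+1 | onDiag-distinct pa pos-i+1 a≢i+1 = sym (+-identityʳ _)

  end-move : ∀ {a b} k → Position T b → b ≢ i → a ≤ τ i b + k * T →
    span i a (b + k * T) ≡ span i a (τ i b + k * T) + onDiag i (τ i b)
  end-move {a} {b} k pb b≢i a≤e with b ≟ suc i
  ... | yes refl rewrite τ-right i = begin
      span i a (suc i + k * T)                     ≡⟨ span-end i a≤e ⟩
      span i a (i + k * T) + onDiag i (i + k * T)  ≡⟨ cong (span i a (i + k * T) +_) (onDiag-period i i k) ⟩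
      span i a (i + k * T) + onDiag i i            ∎
    where open ≡-Reasoning
  ... | no b≢i+1 rewrite τ-fixed i b≢i b≢i+1 | onDiag-distinct pb pos-i b≢i = sym (+-identityʳ _)

  -- Moving the ends of the
  -- hook loses p + q cells of diagonal i, and p + q is the second difference
  -- of the image hook's counts, since its ends avoid diagonals i and i+1.
  hook-transfer : ∀ {a b} k → Position T a → Position T b → π′ a ≡ true → π′ b ≡ false →
    a < b + k * T → τ i a < τ i b + k * T →
    span i a (b + k * T) + span i (τ i a) (τ i b + k * T)
      ≡ span j (τ i a) (τ i b + k * T) + span (suc i) (τ i a) (τ i b + k * T)
  hook-transfer {a} {b} k pa pb a↦1 b↦0 a<e a′<e′ = begin
      span i a (b + k * T) + X                      ≡⟨ cong (_+ X) moved ⟩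
      X + q + p + X                                 ≡⟨ regroup X q p ⟩
      X + X + p + q                                 ≡⟨ cong (X + X + p +_) (onDiag-period i b′ k) ⟨
      X + X + p + onDiag i e′                       ≡⟨ span-secondDiff j (<⇒≤ a′<e′) ⟨
      Sⱼ + Sᵢ₊₁ + onDiag i a′ + onDiag (suc i) e′   ≡⟨ cong₂ (λ x y → Sⱼ + Sᵢ₊₁ + x + y) start-off end-off ⟩
      Sⱼ + Sᵢ₊₁ + 0 + 0                             ≡⟨ trans (+-identityʳ _) (+-identityʳ _) ⟩
      Sⱼ + Sᵢ₊₁                                     ∎
    where
    open ≡-Reasoning
    a′ = τ i a
    b′ = τ i b
    e′ = b′ + k * T
    X = span i a′ e′
    Sⱼ = span j a′ e′
    Sᵢ₊₁ = span (suc i) a′ e′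
    p = onDiag (suc i) a′
    q = onDiag i b′
    moved : span i a (b + k * T) ≡ X + q + p
    moved = trans (start-move pa (π′-filled a↦1) a<e)
                  (cong (_+ p) (end-move k pb (π′-empty b↦0) (<⇒≤ a′<e′)))
    start-off : onDiag i a′ ≡ 0
    start-off = onDiag-distinct (τ-position pa) pos-i (π-filled (trans (π∘τ pa) a↦1))
    end-off : onDiag (suc i) e′ ≡ 0
    end-off = trans (onDiag-period (suc i) b′ k)
                    (onDiag-distinct (τ-position pb) pos-i+1 (π-empty (trans (π∘τ pb) b↦0)))
    regroup : ∀ x y z → x + y + z + x ≡ x + x + z + y
    regroup = solve-∀

  module Relabelling (d′ : LabelledDiagram T π′) (d : LabelledDiagram T π)
    (relabel : ∀ a b k → IsBox T π′ a b k → ¬ Special a b k → lab d (τ i a) (τ i b) k ≡ lab d′ a b k) where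

    m : ℕ
    m = lab d′ i (suc i) 0

    special? : ∀ a b k → Dec (Special a b k)
    special? a b k = a ≟ i ×-dec b ≟ suc i ×-dec k ≟ 0

    removed : ℕ → ℕ → ℕ → ℕ
    removed a b k = if does (special? a b k) then m else 0

    removed-special : removed i (suc i) 0 ≡ m
    removed-special = cong (if_then m else 0) (dec-true (special? i (suc i) 0) (refl , refl , refl))

    removed-elsewhere : ∀ a b k → ¬ Special a b k → removed a b k ≡ 0
    removed-elsewhere a b k ¬special = cong (if_then m else 0) (dec-false (special? a b k) ¬special)

    c′ : ℕ → ℕ → ℕ → ℕ → ℕ
    c′ t a b k = boxContrib T π′ d′ t a b k

    cτ : ℕ → ℕ → ℕ → ℕ → ℕ
    cτ t a b k = boxContrib T π d t (τ i a) (τ i b) k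

    transfer-nonbox : ∀ {a b k} → Position T a → Position T b → ¬ Special a b k → isBoxᵇ T π′ a b k ≡ false →
      c′ i a b k + cτ i a b k ≡ removed a b k + cτ j a b k + cτ (suc i) a b k
    transfer-nonbox {a} {b} {k} pa pb ¬special nonbox = begin
        c′ i a b k + cτ i a b k                        ≡⟨ cong₂ _+_ (boxContrib-nonbox d′ i nonbox) (image-off i) ⟩
        0                                              ≡⟨ cong₂ (λ x y → x + y + 0) (removed-elsewhere a b k ¬special) (image-off j) ⟨
        removed a b k + cτ j a b k + 0                 ≡⟨ cong (removed a b k + cτ j a b k +_) (image-off (suc i)) ⟨
        removed a b k + cτ j a b k + cτ (suc i) a b k  ∎
      where
      open ≡-Reasoning
      image-off : ∀ t → cτ t a b k ≡ 0
      image-off t = boxContrib-nonbox d t (trans (τ-isBox k pa pb ¬special) nonbox)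

    transfer-box : ∀ {a b k} → Position T a → Position T b → ¬ Special a b k → IsBox T π′ a b k →
      c′ i a b k + cτ i a b k ≡ removed a b k + cτ j a b k + cτ (suc i) a b k
    transfer-box {a} {b} {k} pa pb ¬special box = begin
        c′ i a b k + cτ i a b k                    ≡⟨ cong₂ _+_ own-hook (image-hook i) ⟩
        ℓ * span i a e + ℓ * span i a′ e′          ≡⟨ *-distribˡ-+ ℓ _ _ ⟨
        ℓ * (span i a e + span i a′ e′)            ≡⟨ cong (ℓ *_) (hook-transfer k pa pb a↦1 b↦0 (box-hook T π′ k pa pb box) (box-hook T π k pa′ pb′ image-box)) ⟩
        ℓ * (span j a′ e′ + span (suc i) a′ e′)    ≡⟨ *-distribˡ-+ ℓ _ _ ⟩
        ℓ * span j a′ e′ + ℓ * span (suc i) a′ e′  ≡⟨ cong₂ _+_ (image-hook j) (image-hook (suc i)) ⟨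
        cτ j a b k + cτ (suc i) a b k              ≡⟨ cong (λ z → z + cτ j a b k + cτ (suc i) a b k) (removed-elsewhere a b k ¬special) ⟨
        removed a b k + cτ j a b k + cτ (suc i) a b k ∎
      where
      open ≡-Reasoning
      ℓ = lab d′ a b k
      a′ = τ i a
      b′ = τ i b
      e = b + k * T
      e′ = b′ + k * T
      pa′ = τ-position pa
      pb′ = τ-position pb
      a↦1 : π′ a ≡ true
      a↦1 = proj₁ (box-facts T π′ k pa pb box)
      b↦0 : π′ b ≡ false
      b↦0 = proj₁ (proj₂ (box-facts T π′ k pa pb box))
      image-box : IsBox T π a′ b′ k
      image-box = trans (τ-isBox k pa pb ¬special) box
      own-hook : c′ i a b k ≡ ℓ * span i a e
      own-hook = trans (boxContrib-box d′ i box) (cong (ℓ *_) (hook-count i a k (proj₁ pb)))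
      image-hook : ∀ t → cτ t a b k ≡ ℓ * span t a′ e′
      image-hook t = trans (boxContrib-box d t image-box)
                           (cong₂ _*_ (relabel a b k box ¬special) (hook-count t a′ k (proj₁ pb′)))

    contrib-transfer : ∀ a b k → Position T a → Position T b →
      c′ i a b k + cτ i a b k ≡ removed a b k + cτ j a b k + cτ (suc i) a b k
    contrib-transfer a b k pa pb with special? a b k
    ... | yes (refl , refl , refl) = begin
        c′ i i (suc i) 0 + cτ i i (suc i) 0
          ≡⟨ cong₂ _+_ removed-box-hook (image-vanishes i) ⟩
        m * span i i (suc i + 0) + 0
          ≡⟨ cong (λ z → m * span i i z + 0) (+-identityʳ (suc i)) ⟩
        m * span i i (suc i) + 0
          ≡⟨ cong (λ z → m * z + 0) (span-single i) ⟩
        m * 1 + 0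
          ≡⟨ trans (+-identityʳ (m * 1)) (*-identityʳ m) ⟩
        m
          ≡⟨ trans (+-identityʳ (m + 0)) (+-identityʳ m) ⟨
        m + 0 + 0
          ≡⟨ cong₂ (λ x y → x + y + 0) removed-special (image-vanishes j) ⟨
        removed i (suc i) 0 + cτ j i (suc i) 0 + 0
          ≡⟨ cong (removed i (suc i) 0 + cτ j i (suc i) 0 +_) (image-vanishes (suc i)) ⟨
        removed i (suc i) 0 + cτ j i (suc i) 0 + cτ (suc i) i (suc i) 0
          ∎
      where
      open ≡-Reasoning
      removed-box-hook : c′ i i (suc i) 0 ≡ m * span i i (suc i + 0)
      removed-box-hook = trans (boxContrib-box d′ i special-box) (cong (m *_) (hook-count i i 0 (s≤s z≤n)))
      image-vanishes : ∀ t → cτ t i (suc i) 0 ≡ 0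
      image-vanishes t = trans (cong₂ (λ x y → boxContrib T π d t x y 0) (τ-left i) (τ-right i))
                               (boxContrib-nonbox d t special-image)
    ... | no ¬special with isBoxᵇ T π′ a b k Bool.≟ true
    ...   | yes box  = transfer-box pa pb ¬special box
    ...   | no ¬box  = transfer-nonbox pa pb ¬special (¬-not ¬box)

    -- A common bound K for both diagrams; the weights of d are box sums
    -- reindexed along τ, which matches each box of π′ with its image.
    K : ℕ
    K = suc (bound d′ + bound d)

    weight′ : ∀ t → diagWeight T π′ d′ t ≡ boxSum T K (c′ t)
    weight′ t = boxSum-extend T (≤-trans (m≤m+n (bound d′) (bound d)) (n≤1+n _)) (boxContrib-beyond d′ t)

    weight : ∀ t → diagWeight T π d t ≡ boxSum T K (cτ t)
    weight t = trans (boxSum-extend T (≤-trans (m≤n+m (bound d) (bound d′)) (n≤1+n _)) (boxContrib-beyond d t))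
                     (sym (boxSum-τ T K i (boxContrib T π d t) (s≤s z≤n) i+1≤T))

    removed-total : boxSum T K removed ≡ m
    removed-total = trans (boxSum-point T K pos-i pos-i+1 (s≤s z≤n) removed-elsewhere) removed-special

mainTheorem2 : (T : ℕ) → .{{_ : NonZero T}} → 2 ≤ T →
    (i : ℕ) → 1 ≤ i → i ≤ T ∸ 1 →
    (π′ π : ℕ → Bool) →
    (∀ a → 1 ≤ a → a ≤ T → a ≢ i → a ≢ suc i → π′ a ≡ π a) →
    π′ i ≡ true → π′ (suc i) ≡ false → π i ≡ false → π (suc i) ≡ true →
    (d′ : LabelledDiagram T π′) (d : LabelledDiagram T π) →
    (∀ a b k → IsBox T π′ a b k → ¬ (a ≡ i × b ≡ suc i × k ≡ 0) →
      lab d (τ i a) (τ i b) k ≡ lab d′ a b k) →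
    diagWeight T π′ d′ i + diagWeight T π d i
      ≡ lab d′ i (suc i) 0 + diagWeight T π d (i ∸ 1) + diagWeight T π d (suc i)
mainTheorem2 T _ (suc j) _ i≤T∸1 π′ π agree π′i≡1 π′i+1≡0 πi≡0 πi+1≡1 d′ d relabel = begin
    diagWeight T π′ d′ i + diagWeight T π d i
      ≡⟨ cong₂ _+_ (weight′ i) (weight i) ⟩
    boxSum T K (c′ i) + boxSum T K (cτ i)
      ≡⟨ boxSum-+ T K (c′ i) (cτ i) ⟨
    boxSum T K (λ a b k → c′ i a b k + cτ i a b k)
      ≡⟨ boxSum-cong T K contrib-transfer ⟩
    boxSum T K (λ a b k → removed a b k + cτ j a b k + cτ (suc i) a b k)
      ≡⟨ boxSum-+ T K (λ a b k → removed a b k + cτ j a b k) (cτ (suc i)) ⟩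
    boxSum T K (λ a b k → removed a b k + cτ j a b k) + boxSum T K (cτ (suc i))
      ≡⟨ cong (_+ boxSum T K (cτ (suc i))) (boxSum-+ T K removed (cτ j)) ⟩
    boxSum T K removed + boxSum T K (cτ j) + boxSum T K (cτ (suc i))
      ≡⟨ cong₂ _+_ (cong₂ _+_ removed-total (sym (weight j))) (sym (weight (suc i))) ⟩
    lab d′ i (suc i) 0 + diagWeight T π d j + diagWeight T π d (suc i)
      ∎
  where
  open ≡-Reasoning
  i+1≤T : suc (suc j) ≤ T
  i+1≤T = subst (suc (suc j) ≤_) (suc-pred T) (s≤s i≤T∸1)
  open Swap T j i+1≤T π′ π agree π′i≡1 π′i+1≡0 πi≡0 πi+1≡1
  open Relabelling d′ d relabel
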